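{- Let $\mathcal{H}$ be a 1-universal class of hash functions from $U$ to $M$, with $m = |M|$, and let $S \subseteq U$ with $|S| = n$. Choose $h \in \mathcal{H}$ uniformly at random. For $i \in M$ define $B_i = \{y \in S \mid h(y) = i\}$. Then for every $t$ with $2\frac{n}{m} < t \le n$, \[\mathbb{E}_{h\in\mathcal{H}}\bigl[\,|\{x \in S \mid |B_{h(x)}| \ge t\}|\,\bigr] < \frac{n}{t - 2\frac{n}{m}}.\]
   Context: A family $\mathcal{H}$ of functions from $U$ to $M$ is 1-universal if $\Pr_{h\in\mathcal{H}}[h(x) = h(y)] \le 1/|M|$ for all $x, y \in U$ with $x \ne y$, where $h$ is uniform in $\mathcal{H}$. -}

module Defs where

open import Data.Nat using (ℕ; zero; suc; _+_; _*_; _≤_; _<_; _≤?_)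
open import Data.Fin using (Fin; zero; suc; _≟_)
open import Function.Definitions using (Injective)
open import Relation.Nullary using (Dec; yes; no; ¬_)
open import Relation.Binary.PropositionalEquality using (_≡_)

sumFin : (k : ℕ) → (Fin k → ℕ) → ℕ
sumFin zero    f = 0
sumFin (suc k) f = f zero + sumFin k (λ i → f (suc i))

countFin : (k : ℕ) → {P : Fin k → Set} → ((i : Fin k) → Dec (P i)) → ℕ
countFin k d = sumFin k (λ i → indicator (d i))
  where
  indicator : {A : Set} → Dec A → ℕ
  indicator (yes _) = 1
  indicator (no  _) = 0

-- A hash family of size k from U to M = Fin m, as an indexed list
-- (h chosen uniformly at random = index chosen uniformly in Fin k).
HashFamily : ℕ → Set → ℕ → Set
HashFamily k U m = Fin k → U → Fin m

-- 1-universal: Pr_h[h x = h y] ≤ 1/m for x ≠ y, i.e. m · #{h | h x = h y} ≤ k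
OneUniversal : {k : ℕ} {U : Set} {m : ℕ} → HashFamily k U m → Set
OneUniversal {k} {U} {m} H =
  (x y : U) → ¬ (x ≡ y) → m * countFin k (λ j → H j x ≟ H j y) ≤ k

-- S = {s 0, …, s (n-1)} ⊆ U with |S| = n (s injective).
-- |B_i| for the hash function h
bucketSize : {U : Set} {m n : ℕ} → (U → Fin m) → (Fin n → U) → Fin m → ℕ
bucketSize {n = n} h s i = countFin n (λ a → h (s a) ≟ i)

heavyCount : {U : Set} {m n : ℕ} → (U → Fin m) → (Fin n → U) → ℕ → ℕ
heavyCount {n = n} h s t = countFin n (λ a → t ≤? bucketSize h s (h (s a)))

-- Write bᵢ = |Bᵢ|, X(h) for the number of x ∈ S whose bucket is heavy (bᵢ ≥ t), and
-- Q(h) = Σᵢ bᵢ² for the number of ordered colliding pairs of S.  Every bucket satisfies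
-- m²t·bᵢ ≤ m²bᵢ² if it is heavy and 2nm·bᵢ ≤ m²bᵢ² + n² (AM-GM) if it is light;
-- summing over the buckets gives (mt − 2n)·X(h) + n² ≤ m·Q(h) for every single h.
-- By 1-universality the average of Q over the family is at most n + n(n − 1)/m, so
-- the average of (mt − 2n)·X is at most nm − n < nm.
module Submission where

open import Defs
open import Data.Nat using (ℕ; zero; suc; _+_; _*_; _∸_; _≤_; _<_; z≤n; s≤s; _≤?_; NonZero)
open import Data.Nat.Properties
  using (≤-total; ≤-reflexive; <⇒≤; m≤m+n; m<m+n; n≮0; m≤n⇒∃[o]m+o≡n; m+[n∸m]≡n;
         +-comm; +-identityʳ; *-identityˡ; *-identityʳ; *-zeroʳ; *-distribˡ-+; *-distribʳ-+;
         +-mono-≤; +-monoˡ-≤; *-monoʳ-≤; +-cancelʳ-≤; *-cancelˡ-≤; module ≤-Reasoning)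
open import Data.Nat.Tactic.RingSolver using (solve-∀)
open import Data.Fin using (Fin; zero; suc; _≟_)
open import Data.Fin.Properties using (suc-injective)
open import Data.Product using (_,_)
open import Data.Sum using ([_,_]′)
open import Data.Empty using (⊥-elim)
open import Function.Definitions using (Injective)
open import Relation.Nullary using (Dec; yes; no; ¬_)
open import Relation.Binary.PropositionalEquality
  using (_≡_; refl; sym; trans; cong; cong₂; subst; subst₂; module ≡-Reasoning)

sumFin-cong : ∀ k {f g : Fin k → ℕ} → (∀ i → f i ≡ g i) → sumFin k f ≡ sumFin k g
sumFin-cong zero    f≗g = refl
sumFin-cong (suc k) f≗g = cong₂ _+_ (f≗g zero) (sumFin-cong k (λ i → f≗g (suc i)))

sumFin-mono-≤ : ∀ k {f g : Fin k → ℕ} → (∀ i → f i ≤ g i) → sumFin k f ≤ sumFin k g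
sumFin-mono-≤ zero    f≤g = z≤n
sumFin-mono-≤ (suc k) f≤g = +-mono-≤ (f≤g zero) (sumFin-mono-≤ k (λ i → f≤g (suc i)))

sumFin-distrib-+ : ∀ k (f g : Fin k → ℕ) →
  sumFin k (λ i → f i + g i) ≡ sumFin k f + sumFin k g
sumFin-distrib-+ zero    f g = refl
sumFin-distrib-+ (suc k) f g
  rewrite sumFin-distrib-+ k (λ i → f (suc i)) (λ i → g (suc i)) =
  interchange (f zero) (g zero) (sumFin k (λ i → f (suc i))) (sumFin k (λ i → g (suc i)))
  where
  interchange : ∀ a b c d → (a + b) + (c + d) ≡ (a + c) + (b + d)
  interchange = solve-∀

*-distribˡ-sumFin : ∀ k c (f : Fin k → ℕ) → sumFin k (λ i → c * f i) ≡ c * sumFin k f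
*-distribˡ-sumFin zero    c f = sym (*-zeroʳ c)
*-distribˡ-sumFin (suc k) c f rewrite *-distribˡ-sumFin k c (λ i → f (suc i)) =
  sym (*-distribˡ-+ c (f zero) _)

sumFin-const : ∀ k c → sumFin k (λ _ → c) ≡ k * c
sumFin-const zero    c = refl
sumFin-const (suc k) c = cong (c +_) (sumFin-const k c)

sumFin-comm : ∀ k l (f : Fin k → Fin l → ℕ) →
  sumFin k (λ i → sumFin l (f i)) ≡ sumFin l (λ j → sumFin k (λ i → f i j))
sumFin-comm zero    l f = sym (trans (sumFin-const l 0) (*-zeroʳ l))
sumFin-comm (suc k) l f = trans
  (cong (sumFin l (f zero) +_) (sumFin-comm k l (λ i → f (suc i))))
  (sym (sumFin-distrib-+ l (f zero) (λ j → sumFin k (λ i → f (suc i) j))))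

indicator : {A : Set} → Dec A → ℕ
indicator (yes _) = 1
indicator (no  _) = 0

indicator-yes : {A : Set} (d : Dec A) → A → indicator d ≡ 1
indicator-yes (yes _) _ = refl
indicator-yes (no ¬a) a = ⊥-elim (¬a a)

indicator-no : {A : Set} (d : Dec A) → ¬ A → indicator d ≡ 0
indicator-no (yes a) ¬a = ⊥-elim (¬a a)
indicator-no (no  _) _  = refl

indicator-cong : {A B : Set} (da : Dec A) (db : Dec B) → (A → B) → (B → A) →
  indicator da ≡ indicator db
indicator-cong (yes _) (yes _) _ _ = refl
indicator-cong (yes a) (no ¬b) f _ = ⊥-elim (¬b (f a))
indicator-cong (no ¬a) (yes b) _ g = ⊥-elim (¬a (g b))
indicator-cong (no  _) (no  _) _ _ = refl

countFin≡sumFin-indicator : ∀ k {P : Fin k → Set} (d : (i : Fin k) → Dec (P i)) →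
  countFin k d ≡ sumFin k (λ i → indicator (d i))
countFin≡sumFin-indicator zero    d = refl
countFin≡sumFin-indicator (suc k) d with d zero
... | yes _ = cong suc (countFin≡sumFin-indicator k (λ i → d (suc i)))
... | no  _ = countFin≡sumFin-indicator k (λ i → d (suc i))

sumFin-select : ∀ k (a : Fin k) (g : Fin k → ℕ) →
  sumFin k (λ i → indicator (a ≟ i) * g i) ≡ g a
sumFin-select (suc k) zero g = begin
  indicator (_≟_ {suc k} zero zero) * g zero + sumFin k (λ i → indicator (zero ≟ suc i) * g (suc i))
    ≡⟨ cong₂ _+_ (cong (_* g zero) (indicator-yes (_≟_ {suc k} zero zero) refl))
                 (sumFin-cong k (λ i → cong (_* g (suc i)) (indicator-no (zero ≟ suc i) λ ()))) ⟩
  1 * g zero + sumFin k (λ _ → 0)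
    ≡⟨ cong₂ _+_ (*-identityˡ (g zero)) (trans (sumFin-const k 0) (*-zeroʳ k)) ⟩
  g zero + 0
    ≡⟨ +-identityʳ (g zero) ⟩
  g zero ∎
  where open ≡-Reasoning
sumFin-select (suc k) (suc a) g = begin
  indicator (suc a ≟ zero) * g zero + sumFin k (λ i → indicator (suc a ≟ suc i) * g (suc i))
    ≡⟨ cong₂ _+_ (cong (_* g zero) (indicator-no (suc a ≟ zero) λ ()))
                 (sumFin-cong k (λ i → cong (_* g (suc i))
                   (indicator-cong (suc a ≟ suc i) (a ≟ i) suc-injective (cong suc)))) ⟩
  sumFin k (λ i → indicator (a ≟ i) * g (suc i))
    ≡⟨ sumFin-select k a (λ i → g (suc i)) ⟩
  g (suc a) ∎
  where open ≡-Reasoning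

sumFin-fibres : ∀ n m (f : Fin n → Fin m) (g : Fin m → ℕ) →
  sumFin n (λ a → g (f a)) ≡ sumFin m (λ i → sumFin n (λ a → indicator (f a ≟ i)) * g i)
sumFin-fibres zero    m f g = sym (trans (sumFin-const m 0) (*-zeroʳ m))
sumFin-fibres (suc n) m f g = begin
  g (f zero) + sumFin n (λ a → g (f (suc a)))
    ≡⟨ cong₂ _+_ (sym (sumFin-select m (f zero) g)) (sumFin-fibres n m (λ a → f (suc a)) g) ⟩
  sumFin m (λ i → indicator (f zero ≟ i) * g i) + sumFin m (λ i → fibre i * g i)
    ≡⟨ sym (sumFin-distrib-+ m _ _) ⟩
  sumFin m (λ i → indicator (f zero ≟ i) * g i + fibre i * g i)
    ≡⟨ sumFin-cong m (λ i → sym (*-distribʳ-+ (g i) (indicator (f zero ≟ i)) (fibre i))) ⟩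
  sumFin m (λ i → (indicator (f zero ≟ i) + fibre i) * g i) ∎
  where
  open ≡-Reasoning
  fibre : Fin m → ℕ
  fibre i = sumFin n (λ a → indicator (f (suc a) ≟ i))

sumFin-lincomb : ∀ k a b (f g : Fin k → ℕ) →
  sumFin k (λ i → a * f i + b * g i) ≡ a * sumFin k f + b * sumFin k g
sumFin-lincomb k a b f g = trans (sumFin-distrib-+ k (λ i → a * f i) (λ i → b * g i))
  (cong₂ _+_ (*-distribˡ-sumFin k a f) (*-distribˡ-sumFin k b g))

2*m*n≤m*m+n*n : ∀ m n → 2 * m * n ≤ m * m + n * n
2*m*n≤m*m+n*n m n = [ ordered
                     , (λ m≤n → subst₂ _≤_ (swap-factors n m) (+-comm (n * n) (m * m)) (ordered m≤n))
                     ]′ (≤-total n m)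
  where
  swap-factors : ∀ n m → 2 * n * m ≡ 2 * m * n
  swap-factors = solve-∀
  square-expansion : ∀ n d → 2 * (n + d) * n + d * d ≡ (n + d) * (n + d) + n * n
  square-expansion = solve-∀
  ordered : ∀ {n m} → n ≤ m → 2 * m * n ≤ m * m + n * n
  ordered {n} n≤m with m≤n⇒∃[o]m+o≡n n≤m
  ... | d , refl = subst (2 * (n + d) * n ≤_) (square-expansion n d) (m≤m+n _ (d * d))

heavyPart : ℕ → ℕ → ℕ
heavyPart t b = b * indicator (t ≤? b)

heavyPart-bound : ∀ m n t b →
  m * m * t * heavyPart t b + 2 * n * m * b ≤ m * m * (b * b) + 2 * n * m * heavyPart t b + n * n
heavyPart-bound m n t b with t ≤? b
... | yes t≤b = begin
  m * m * t * (b * 1) + 2 * n * m * b    ≡⟨ heavy-lhs m n t b ⟩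
  m * m * (b * t) + 2 * n * m * b        ≤⟨ +-monoˡ-≤ _ (*-monoʳ-≤ (m * m) (*-monoʳ-≤ b t≤b)) ⟩
  m * m * (b * b) + 2 * n * m * b        ≤⟨ m≤m+n _ (n * n) ⟩
  m * m * (b * b) + 2 * n * m * b + n * n ≡⟨ heavy-rhs m n b ⟩
  m * m * (b * b) + 2 * n * m * (b * 1) + n * n ∎
  where
  open ≤-Reasoning
  heavy-lhs : ∀ m n t b → m * m * t * (b * 1) + 2 * n * m * b ≡ m * m * (b * t) + 2 * n * m * b
  heavy-lhs = solve-∀
  heavy-rhs : ∀ m n b → m * m * (b * b) + 2 * n * m * b + n * n ≡ m * m * (b * b) + 2 * n * m * (b * 1) + n * n
  heavy-rhs = solve-∀
... | no _ = subst₂ _≤_ (light-lhs m n t b) (light-rhs m n b) (2*m*n≤m*m+n*n (m * b) n)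
  where
  light-lhs : ∀ m n t b → 2 * (m * b) * n ≡ m * m * t * (b * 0) + 2 * n * m * b
  light-lhs = solve-∀
  light-rhs : ∀ m n b → m * b * (m * b) + n * n ≡ m * m * (b * b) + 2 * n * m * (b * 0) + n * n
  light-rhs = solve-∀

collisions : {U : Set} {m n : ℕ} → (U → Fin m) → (Fin n → U) → ℕ
collisions {n = n} h s = sumFin n (λ a → bucketSize h s (h (s a)))

module _ {U : Set} {m n : ℕ} (h : U → Fin m) (s : Fin n → U) where

  sumFin-over-buckets : (g : Fin m → ℕ) →
    sumFin n (λ a → g (h (s a))) ≡ sumFin m (λ i → bucketSize h s i * g i)
  sumFin-over-buckets g = trans (sumFin-fibres n m (λ a → h (s a)) g)
    (sumFin-cong m (λ i → cong (_* g i) (sym (countFin≡sumFin-indicator n (λ a → h (s a) ≟ i)))))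

  sumFin-bucketSize : sumFin m (bucketSize h s) ≡ n
  sumFin-bucketSize = begin
    sumFin m (bucketSize h s)                  ≡⟨ sumFin-cong m (λ i → sym (*-identityʳ (bucketSize h s i))) ⟩
    sumFin m (λ i → bucketSize h s i * 1)      ≡⟨ sym (sumFin-over-buckets (λ _ → 1)) ⟩
    sumFin n (λ _ → 1)                         ≡⟨ sumFin-const n 1 ⟩
    n * 1                                      ≡⟨ *-identityʳ n ⟩
    n                                          ∎
    where open ≡-Reasoning

  heavyCount≡sumFin-heavyPart : ∀ t → heavyCount h s t ≡ sumFin m (λ i → heavyPart t (bucketSize h s i))
  heavyCount≡sumFin-heavyPart t = trans (countFin≡sumFin-indicator n _)
    (sumFin-over-buckets (λ i → indicator (t ≤? bucketSize h s i)))

  collisions≡sumFin-square : collisions h s ≡ sumFin m (λ i → bucketSize h s i * bucketSize h s i)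
  collisions≡sumFin-square = sumFin-over-buckets (bucketSize h s)

  heavyCount-bound : ∀ t .{{_ : NonZero m}} →
    m * t * heavyCount h s t + n * n ≤ m * collisions h s + 2 * n * heavyCount h s t
  heavyCount-bound t = *-cancelˡ-≤ m (+-cancelʳ-≤ (m * (n * n)) _ _ (begin
    m * (m * t * X + n * n) + m * (n * n)
      ≡⟨ regroup-lhs m n t X ⟩
    m * m * t * X + 2 * n * m * n
      ≡⟨ sym (trans (sumFin-lincomb m (m * m * t) (2 * n * m) heavy b)
                    (cong₂ (λ x y → m * m * t * x + 2 * n * m * y)
                           (sym (heavyCount≡sumFin-heavyPart t)) sumFin-bucketSize)) ⟩
    sumFin m (λ i → m * m * t * heavy i + 2 * n * m * b i)
      ≤⟨ sumFin-mono-≤ m (λ i → heavyPart-bound m n t (b i)) ⟩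
    sumFin m (λ i → m * m * (b i * b i) + 2 * n * m * heavy i + n * n)
      ≡⟨ sumFin-distrib-+ m _ (λ _ → n * n) ⟩
    sumFin m (λ i → m * m * (b i * b i) + 2 * n * m * heavy i) + sumFin m (λ _ → n * n)
      ≡⟨ cong₂ _+_ (trans (sumFin-lincomb m (m * m) (2 * n * m) (λ i → b i * b i) heavy)
                          (cong₂ (λ x y → m * m * x + 2 * n * m * y)
                                 (sym collisions≡sumFin-square) (sym (heavyCount≡sumFin-heavyPart t))))
                   (sumFin-const m (n * n)) ⟩
    m * m * Q + 2 * n * m * X + m * (n * n)
      ≡⟨ regroup-rhs m n X Q ⟩
    m * (m * Q + 2 * n * X) + m * (n * n) ∎))
    where
    open ≤-Reasoning
    b : Fin m → ℕ
    b = bucketSize h s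
    heavy : Fin m → ℕ
    heavy i = heavyPart t (b i)
    X Q : ℕ
    X = heavyCount h s t
    Q = collisions h s
    regroup-lhs : ∀ m n t X → m * (m * t * X + n * n) + m * (n * n) ≡ m * m * t * X + 2 * n * m * n
    regroup-lhs = solve-∀
    regroup-rhs : ∀ m n X Q → m * m * Q + 2 * n * m * X + m * (n * n) ≡ m * (m * Q + 2 * n * X) + m * (n * n)
    regroup-rhs = solve-∀

module _ {U : Set} {k m n : ℕ} (H : HashFamily k U m) (s : Fin n → U) where

  sumFin-heavyCount-bound : ∀ t .{{_ : NonZero m}} →
    m * t * sumFin k (λ j → heavyCount (H j) s t) + k * (n * n)
      ≤ m * sumFin k (λ j → collisions (H j) s) + 2 * n * sumFin k (λ j → heavyCount (H j) s t)
  sumFin-heavyCount-bound t = subst₂ _≤_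
    (trans (sumFin-distrib-+ k _ (λ _ → n * n))
           (cong₂ _+_ (*-distribˡ-sumFin k (m * t) _) (sumFin-const k (n * n))))
    (sumFin-lincomb k m (2 * n) _ _)
    (sumFin-mono-≤ k (λ j → heavyCount-bound (H j) s t))

  pairCollisions : Fin n → Fin n → ℕ
  pairCollisions a a' = countFin k (λ j → H j (s a') ≟ H j (s a))

  sumFin-collisions : sumFin k (λ j → collisions (H j) s) ≡ sumFin n (λ a → sumFin n (pairCollisions a))
  sumFin-collisions = begin
    sumFin k (λ j → sumFin n (λ a → countFin n (λ a' → H j (s a') ≟ H j (s a))))
      ≡⟨ sumFin-cong k (λ j → sumFin-cong n (λ a → countFin≡sumFin-indicator n _)) ⟩
    sumFin k (λ j → sumFin n (λ a → sumFin n (λ a' → collide j a a')))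
      ≡⟨ sumFin-comm k n _ ⟩
    sumFin n (λ a → sumFin k (λ j → sumFin n (λ a' → collide j a a')))
      ≡⟨ sumFin-cong n (λ a → sumFin-comm k n _) ⟩
    sumFin n (λ a → sumFin n (λ a' → sumFin k (λ j → collide j a a')))
      ≡⟨ sumFin-cong n (λ a → sumFin-cong n (λ a' → sym (countFin≡sumFin-indicator k _))) ⟩
    sumFin n (λ a → sumFin n (pairCollisions a)) ∎
    where
    open ≡-Reasoning
    collide : Fin k → Fin n → Fin n → ℕ
    collide j a a' = indicator (H j (s a') ≟ H j (s a))

  pairCollisions-diagonal : ∀ a → pairCollisions a a ≡ k
  pairCollisions-diagonal a = begin
    pairCollisions a a
      ≡⟨ countFin≡sumFin-indicator k _ ⟩
    sumFin k (λ j → indicator (H j (s a) ≟ H j (s a)))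
      ≡⟨ sumFin-cong k (λ j → indicator-yes (H j (s a) ≟ H j (s a)) refl) ⟩
    sumFin k (λ _ → 1)
      ≡⟨ sumFin-const k 1 ⟩
    k * 1
      ≡⟨ *-identityʳ k ⟩
    k ∎
    where open ≡-Reasoning

  module _ (universal : OneUniversal H) (s-injective : Injective _≡_ _≡_ s) where

    -- The indicators fold the diagonal case (count k) into one subtraction-free inequality.
    pairCollisions-bound : ∀ a a' →
      m * pairCollisions a a' + indicator (a ≟ a') * k ≤ k + indicator (a ≟ a') * (m * k)
    pairCollisions-bound a a' with a ≟ a'
    ... | yes refl = ≤-reflexive (begin
      m * pairCollisions a a + 1 * k   ≡⟨ cong (λ c → m * c + 1 * k) (pairCollisions-diagonal a) ⟩
      m * k + 1 * k                    ≡⟨ swap-summands m k ⟩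
      k + 1 * (m * k)                  ∎)
      where
      open ≡-Reasoning
      swap-summands : ∀ m k → m * k + 1 * k ≡ k + 1 * (m * k)
      swap-summands = solve-∀
    ... | no a≢a' = subst₂ _≤_ (sym (+-identityʳ _)) (sym (+-identityʳ k))
      (universal (s a') (s a) (λ sa'≡sa → a≢a' (sym (s-injective sa'≡sa))))

    collisions-bound : m * sumFin k (λ j → collisions (H j) s) + n * k ≤ n * (n * k + m * k)
    collisions-bound = begin
      m * sumFin k (λ j → collisions (H j) s) + n * k
        ≡⟨ cong₂ _+_ (cong (m *_) sumFin-collisions) (sym (sumFin-const n k)) ⟩
      m * sumFin n (λ a → sumFin n (pairCollisions a)) + sumFin n (λ _ → k)
        ≡⟨ cong (_+ sumFin n (λ _ → k)) (sym (*-distribˡ-sumFin n m _)) ⟩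
      sumFin n (λ a → m * sumFin n (pairCollisions a)) + sumFin n (λ _ → k)
        ≡⟨ sym (sumFin-distrib-+ n _ _) ⟩
      sumFin n (λ a → m * sumFin n (pairCollisions a) + k)
        ≤⟨ sumFin-mono-≤ n row-bound ⟩
      sumFin n (λ _ → n * k + m * k)
        ≡⟨ sumFin-const n (n * k + m * k) ⟩
      n * (n * k + m * k) ∎
      where
      open ≤-Reasoning
      row-bound : ∀ a → m * sumFin n (pairCollisions a) + k ≤ n * k + m * k
      row-bound a = subst₂ _≤_
        (trans (sumFin-distrib-+ n _ _) (cong₂ _+_ (*-distribˡ-sumFin n m _) (sumFin-select n a (λ _ → k))))
        (trans (sumFin-distrib-+ n _ _) (cong₂ _+_ (sumFin-const n k) (sumFin-select n a (λ _ → m * k))))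
        (sumFin-mono-≤ n (pairCollisions-bound a))

excess-bound : ∀ m n t K X Q → 2 * n ≤ m * t →
  m * t * X + K * (n * n) ≤ m * Q + 2 * n * X →
  m * Q + n * K ≤ n * (n * K + m * K) →
  0 < n * K →
  X * (m * t ∸ 2 * n) < K * n * m
excess-bound m n t K X Q 2n≤mt heavy-bound collision-bound 0<nK = begin-strict
  X * d                           <⟨ m<m+n (X * d) 0<nK ⟩
  X * d + n * K                   ≤⟨ +-cancelʳ-≤ A _ _ (begin
    X * d + n * K + A                        ≡⟨ regroup-lhs X d n K ⟩
    (2 * n + d) * X + K * (n * n) + n * K     ≡⟨ cong (λ c → c * X + K * (n * n) + n * K)
                                                     (m+[n∸m]≡n 2n≤mt) ⟩
    m * t * X + K * (n * n) + n * K           ≤⟨ +-monoˡ-≤ (n * K) heavy-bound ⟩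
    m * Q + 2 * n * X + n * K                 ≡⟨ regroup-middle m Q n X K ⟩
    m * Q + n * K + 2 * n * X                 ≤⟨ +-monoˡ-≤ (2 * n * X) collision-bound ⟩
    n * (n * K + m * K) + 2 * n * X           ≡⟨ regroup-rhs n K m X ⟩
    K * n * m + A                             ∎) ⟩
  K * n * m                       ∎
  where
  open ≤-Reasoning
  d A : ℕ
  d = m * t ∸ 2 * n
  A = 2 * n * X + K * (n * n)
  regroup-lhs : ∀ X d n K → X * d + n * K + (2 * n * X + K * (n * n)) ≡ (2 * n + d) * X + K * (n * n) + n * K
  regroup-lhs = solve-∀
  regroup-middle : ∀ m Q n X K → m * Q + 2 * n * X + n * K ≡ m * Q + n * K + 2 * n * X
  regroup-middle = solve-∀
  regroup-rhs : ∀ n K m X → n * (n * K + m * K) + 2 * n * X ≡ K * n * m + (2 * n * X + K * (n * n))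
  regroup-rhs = solve-∀

lemma4 : {U : Set} (k m n : ℕ) (H : HashFamily (suc k) U m) → OneUniversal H →
    (s : Fin n → U) → Injective _≡_ _≡_ s → (t : ℕ) → 2 * n < m * t → t ≤ n →
      sumFin (suc k) (λ j → heavyCount (H j) s t) * (m * t ∸ 2 * n) < suc k * n * m
lemma4 k zero      n         _ _         _ _           _ ()    _
lemma4 k m@(suc _) zero      _ _         _ _           _ 0<mt  z≤n =
  ⊥-elim (n≮0 (subst (0 <_) (*-zeroʳ m) 0<mt))
lemma4 k m@(suc _) n@(suc _) H universal s s-injective t 2n<mt _ =
  excess-bound m n t (suc k) _ _ (<⇒≤ 2n<mt)
    (sumFin-heavyCount-bound H s t)
    (collisions-bound H s universal s-injective)
    (s≤s z≤n)
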